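{- Let $m,n\geq0$ and $\mathbf{u},\mathbf{v}\in\mathsf{Shuf}(m,n)$. Let $\tilde{\mathbf{w}}=x_{j_1}x_{j_2}\cdots x_{j_s}y_{k_1}y_{k_2}\cdots y_{k_t}$, where $\{x_{j_1},\dots,x_{j_s}\}$ (with $j_1<\dots<j_s$) is the set of letters of $X$ occurring in both $\mathbf{u}$ and $\mathbf{v}$, and $\{y_{k_1},\dots,y_{k_t}\}$ (with $k_1<\dots<k_t$) is the set of letters of $Y$ occurring in $\mathbf{u}$ or in $\mathbf{v}$. Then the join $\mathbf{w}=\mathbf{u}\vee\mathbf{v}$ in $\mathbf{Bub}(m,n)$ satisfies $\mathbf{w}_{\mathbf{x}}=\tilde{\mathbf{w}}_{\mathbf{x}}$, $\mathbf{w}_{\mathbf{y}}=\tilde{\mathbf{w}}_{\mathbf{y}}$ and $\mathsf{Inv}(\mathbf{w})=\mathsf{Inv}\bigl((\mathbf{u}^{\mathbf{y}})_{\tilde{\mathbf{w}}}\bigr)\cup\mathsf{Inv}\bigl((\mathbf{v}^{\mathbf{y}})_{\tilde{\mathbf{w}}}\bigr)$, and it is the unique element of $\mathsf{Shuf}(m,n)$ with these three properties.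
   Context: Disjoint alphabets $X=\{x_1,\dots,x_m\}$, $Y=\{y_1,\dots,y_n\}$; $\mathbf{x}=x_1\cdots x_m$, $\mathbf{y}=y_1\cdots y_n$. A word is simple if it has no repeated letter; a subword of $w_1\cdots w_k$ is $w_{i_1}\cdots w_{i_l}$ with $i_1<\dots<i_l$. For simple words $\mathbf{u},\mathbf{v}$, the restriction $\mathbf{u}_{\mathbf{v}}$ is the subword of $\mathbf{u}$ formed by letters occurring in both. $\mathsf{Shuf}(m,n)$ is the set of simple words $\mathbf{u}$ over $X\cup Y$ with $\mathbf{u}_{\mathbf{x}}$ a subword of $\mathbf{x}$ and $\mathbf{u}_{\mathbf{y}}$ a subword of $\mathbf{y}$. $\mathsf{Inv}(\mathbf{u})=\{(x_s,y_t): y_t\text{ occurs before }x_s\text{ in }\mathbf{u}\}$. For $\mathbf{u}=u_1\cdots u_k$, $\mathbf{u}_{\hat\imath}$ is $\mathbf{u}$ with $u_i$ deleted. Indels: $\mathbf{u}\to\mathbf{u}_{\hat\imath}$ if $u_i\in X$, and $\mathbf{u}_{\hat\imath}\to\mathbf{u}$ if $u_i\in Y$. Transpositions: $\mathbf{u}\Rightarrow\mathbf{u}'$ where $u_i\in X$, $u_{i+1}\in Y$ and $\mathbf{u}'$ is $\mathbf{u}$ with $u_i,u_{i+1}$ swapped. The bubble order $\leq_{\mathsf{bub}}$ is the reflexive transitive closure of indels and transpositions; $\mathbf{Bub}(m,n)=(\mathsf{Shuf}(m,n),\leq_{\mathsf{bub}})$, which is a lattice. The $\mathbf{y}$-filling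 $\mathbf{u}^{\mathbf{y}}$: let $Y\setminus\mathbf{u}_{\mathbf{y}}=\{y_{j_1},\dots,y_{j_r}\}$ with $j_1>\dots>j_r$. Set $\mathbf{u}^{(0)}=\mathbf{u}$ and, for $i\in[r]$, obtain $\mathbf{u}^{(i)}$ from $\mathbf{u}^{(i-1)}$ by inserting $y_{j_i}$ immediately to the left of $y_{t_i}$, where $t_i=\min\{k: k>j_i,\ y_k\in\mathbf{u}^{(i-1)}\}$, or appending $y_{j_i}$ at the end if no such $k$ exists. Then $\mathbf{u}^{\mathbf{y}}=\mathbf{u}^{(r)}$. -}

module Defs where

open import Data.Nat using (ℕ)
open import Data.Fin using (Fin; _<_)
open import Data.Fin.Properties using (_<?_) renaming (_≟_ to _≟F_)
open import Data.List using (List; []; _∷_; _++_; map; filter; foldr; [_]; allFin)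
open import Data.List.Relation.Unary.Unique.Propositional using (Unique)
open import Data.List.Relation.Binary.Sublist.Propositional using (_⊆_)
open import Data.List.Membership.Propositional using (_∈_)
open import Data.List.Relation.Unary.Any using (any?)
open import Data.Maybe using (Maybe; just; nothing)
open import Data.Product using (_×_; _,_; ∃-syntax)
open import Data.Sum using (_⊎_)
open import Function.Bundles using (_⇔_)
open import Relation.Nullary using (Dec; yes; no; ¬_; _×-dec_; _⊎-dec_)
open import Relation.Binary.PropositionalEquality using (_≡_; refl)
open import Relation.Binary.Construct.Closure.ReflexiveTransitive using (Star)

-- Letters of X ∪ Y: (xl s) is x_{s+1} (s : Fin m), (yl t) is y_{t+1} (t : Fin n).
-- X and Y are disjoint by construction.
data Letter (m n : ℕ) : Set where
  xl : Fin m → Letter m n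
  yl : Fin n → Letter m n

Word : ℕ → ℕ → Set
Word m n = List (Letter m n)

module _ {m n : ℕ} where

  _≟L_ : (a b : Letter m n) → Dec (a ≡ b)
  xl s ≟L xl s' with s ≟F s'
  ... | yes refl = yes refl
  ... | no ne = no λ { refl → ne refl }
  xl s ≟L yl t = no λ ()
  yl t ≟L xl s = no λ ()
  yl t ≟L yl t' with t ≟F t'
  ... | yes refl = yes refl
  ... | no ne = no λ { refl → ne refl }

  _∈?_ : (a : Letter m n) (w : Word m n) → Dec (a ∈ w)
  a ∈? w = any? (a ≟L_) w

  xword : Word m n
  xword = map xl (allFin m)

  yword : Word m n
  yword = map yl (allFin n)

  restrict : Word m n → Word m n → Word m n
  restrict u v = filter (λ a → a ∈? v) u

  Simple : Word m n → Set
  Simple = Unique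

  Shuf : Word m n → Set
  Shuf u = Simple u × (restrict u xword ⊆ xword) × (restrict u yword ⊆ yword)

  Inv : Word m n → Fin m → Fin n → Set
  Inv u s t = ∃[ a ] ∃[ b ] (u ≡ a ++ b × yl t ∈ a × xl s ∈ b)

  data Move : Word m n → Word m n → Set where
    del  : ∀ a b s → Move (a ++ xl s ∷ b) (a ++ b)
    ins  : ∀ a b t → Move (a ++ b) (a ++ yl t ∷ b)
    swap : ∀ a b s t → Move (a ++ xl s ∷ yl t ∷ b) (a ++ yl t ∷ xl s ∷ b)

  BubStep : Word m n → Word m n → Set
  BubStep u v = Shuf u × Shuf v × Move u v

  _≤bub_ : Word m n → Word m n → Set
  u ≤bub v = Star BubStep u v

  IsJoin : Word m n → Word m n → Word m n → Set
  IsJoin u v w = Shuf w × u ≤bub w × v ≤bub w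
                 × (∀ z → Shuf z → u ≤bub z → v ≤bub z → w ≤bub z)

  -- y-filling
  -- least k with j < k and y_k occurring in w (allFin is increasing)
  nextY : Fin n → Word m n → Maybe (Fin n)
  nextY j w with filter (λ k → (j <? k) ×-dec (yl k ∈? w)) (allFin n)
  ... | []    = nothing
  ... | k ∷ _ = just k

  insertLeftOf : Letter m n → Letter m n → Word m n → Word m n
  insertLeftOf a b [] = []
  insertLeftOf a b (c ∷ w) with c ≟L b
  ... | yes _ = a ∷ c ∷ w
  ... | no _  = c ∷ insertLeftOf a b w

  fillStep : Fin n → Word m n → Word m n
  fillStep j w with yl j ∈? w
  ... | yes _ = w
  fillStep j w | no _ with nextY j w
  ... | just k  = insertLeftOf (yl j) (yl k) w
  ... | nothing = w ++ [ yl j ]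

  -- missing letters y_j are inserted in decreasing order of j:
  -- foldr applies fillStep to n-1 first, then n-2, ..., then 0;
  -- letters already present are skipped.
  yFill : Word m n → Word m n
  yFill u = foldr fillStep u (allFin n)

  wTilde : Word m n → Word m n → Word m n
  wTilde u v =
    map xl (filter (λ s → (xl s ∈? u) ×-dec (xl s ∈? v)) (allFin m))
    ++ map yl (filter (λ t → (yl t ∈? u) ⊎-dec (yl t ∈? v)) (allFin n))

  JoinProps : Word m n → Word m n → Word m n → Set
  JoinProps u v w =
    (restrict w xword ≡ restrict (wTilde u v) xword)
    × (restrict w yword ≡ restrict (wTilde u v) yword)
    × (∀ s t → Inv w s t ⇔
         (Inv (restrict (yFill u) (wTilde u v)) s t
          ⊎ Inv (restrict (yFill v) (wTilde u v)) s t))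

-- Words of Shuf(m,n) are the words whose X-letters and Y-letters each occur in increasing order,
-- and on them u ≤bub z is equivalent to u ⊑ z: z has fewer X-letters and more Y-letters, and
-- whenever some y_k with k ≥ t precedes an x_s of z in u, some such y_k precedes x_s in z.
-- Moves preserve ⊑; conversely a path is built by comparing first letters. The merge J of the
-- X-letters common to u and v and the Y-letters of either, with y_t before x_s exactly when u or
-- v has some y_k (k ≥ t) before x_s, is an upper bound whose data every upper bound contains.
-- The join w lies below J, so it has the letters of 𝐰̃ and the same such pairs as J. The
-- y-filling of u keeps the pairs of u and contains every y_t, so its restriction to 𝐰̃ lists
-- exactly the inversions of w coming from u. A sorted word is determined by its letters and
-- inversions, which gives uniqueness.
module Submission where

open import Defs
open import Data.Nat as ℕ using (ℕ; zero; suc; _+_)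
import Data.Nat.Properties as ℕ
open import Data.Fin as Fin using (Fin; _<_; _≤_)
import Data.Fin.Properties as Fin
open import Data.List using (List; []; _∷_; _++_; map; filter; foldr; [_]; allFin; length)
import Data.List.Properties as List
open import Data.List.Relation.Unary.All as All using (All; _∷_)
open import Data.List.Relation.Unary.Any using (here; there)
open import Data.List.Relation.Unary.AllPairs as AllPairs using (AllPairs; []; _∷_)
import Data.List.Relation.Unary.AllPairs.Properties as AllPairs
open import Data.List.Relation.Unary.Unique.Propositional using (Unique)
open import Data.List.Relation.Unary.Unique.Propositional.Properties using (Unique[x∷xs]⇒x∉xs)
open import Data.List.Relation.Binary.Sublist.Propositional
  using (_⊆_; _∷_; _∷ʳ_; lookup; minimum; ⊆-refl; ⊆-antisym)
import Data.List.Relation.Binary.Sublist.Propositional.Properties as Sublist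
open import Data.List.Membership.Propositional using (_∈_; _∉_)
open import Data.List.Membership.Propositional.Properties
import Data.List.Relation.Binary.Permutation.Propositional as ↭
open import Data.List.Relation.Binary.Permutation.Propositional.Properties as ↭ using (∈-resp-↭)
open import Data.Product using (_×_; _,_; ∃-syntax; proj₁; proj₂)
open import Data.Maybe using (just; nothing)
open import Data.Sum using (_⊎_; inj₁; inj₂)
open import Data.Empty using (⊥; ⊥-elim)
open import Data.Unit using (⊤; tt)
open import Data.Bool using (if_then_else_)
open import Relation.Nullary using (¬_; Dec; does; yes; no; _×-dec_; _⊎-dec_)
import Relation.Nullary.Decidable as Decidable
import Relation.Unary as U
open import Function.Bundles using (_⇔_; mk⇔; Equivalence)
open Equivalence using (to; from)
open import Relation.Binary.Construct.Closure.ReflexiveTransitive using (ε; _◅_; _◅◅_)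
open import Relation.Binary.PropositionalEquality using (_≡_; _≢_; refl; sym; cong; subst)

-- Precedence in lists

module _ {A : Set} where

  private
    variable
      R : A → A → Set
      a b c d : A
      p q w : List A

  data Before : List A → A → A → Set where
    first : b ∈ w → Before (a ∷ w) a b
    later : Before w a b → Before (c ∷ w) a b

  Before⇒∈ˡ : Before w a b → a ∈ w
  Before⇒∈ˡ (first _) = here refl
  Before⇒∈ˡ (later r) = there (Before⇒∈ˡ r)

  Before⇒∈ʳ : Before w a b → b ∈ w
  Before⇒∈ʳ (first b∈) = there b∈
  Before⇒∈ʳ (later r) = there (Before⇒∈ʳ r)

  Before-∷⇒∈ʳ : Before (c ∷ w) a b → b ∈ w
  Before-∷⇒∈ʳ (first b∈) = b∈
  Before-∷⇒∈ʳ (later r) = Before⇒∈ʳ r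

  Before-irrefl : Unique w → ¬ Before w a a
  Before-irrefl (a∉ ∷ _) (first a∈) = All.lookup a∉ a∈ refl
  Before-irrefl (_ ∷ u) (later r) = Before-irrefl u r

  Before-trans : Unique w → Before w a b → Before w b c → Before w a c
  Before-trans _ (first _) r = first (Before-∷⇒∈ʳ r)
  Before-trans (b∉ ∷ _) (later r) (first _) = ⊥-elim (All.lookup b∉ (Before⇒∈ʳ r) refl)
  Before-trans (_ ∷ u) (later r) (later r′) = later (Before-trans u r r′)

  Before-asym : Unique w → Before w a b → ¬ Before w b a
  Before-asym u r r′ = Before-irrefl u (Before-trans u r r′)

  Before-connex : a ∈ w → b ∈ w → a ≢ b → Before w a b ⊎ Before w b a
  Before-connex (here refl) (here refl) a≢b = ⊥-elim (a≢b refl)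
  Before-connex (here refl) (there b∈) _ = inj₁ (first b∈)
  Before-connex (there a∈) (here refl) _ = inj₂ (first a∈)
  Before-connex (there a∈) (there b∈) a≢b with Before-connex a∈ b∈ a≢b
  ... | inj₁ r = inj₁ (later r)
  ... | inj₂ r = inj₂ (later r)

  AllPairs-Before : AllPairs R w → Before w a b → R a b
  AllPairs-Before (ps ∷ _) (first b∈) = All.lookup ps b∈
  AllPairs-Before (_ ∷ pss) (later r) = AllPairs-Before pss r

  Before⇒AllPairs : (∀ {a b} → Before w a b → R a b) → AllPairs R w
  Before⇒AllPairs {w = []} _ = []
  Before⇒AllPairs {w = c ∷ w} h = All.tabulate (λ b∈ → h (first b∈)) ∷ Before⇒AllPairs (λ r → h (later r))

  Before-++ : a ∈ p → b ∈ q → Before (p ++ q) a b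
  Before-++ {p = _ ∷ p} (here refl) b∈ = first (∈-++⁺ʳ p b∈)
  Before-++ {p = _ ∷ p} (there a∈) b∈ = later (Before-++ a∈ b∈)

  Before⇒++ : Before w a b → ∃[ p ] ∃[ q ] (w ≡ p ++ q × a ∈ p × b ∈ q)
  Before⇒++ (first {b} {w} {a} b∈) = [ a ] , w , refl , here refl , b∈
  Before⇒++ (later {c = c} r) with Before⇒++ r
  ... | p , q , refl , a∈ , b∈ = c ∷ p , q , refl , there a∈ , b∈

  Before-resp-⊆ : p ⊆ q → Before p a b → Before q a b
  Before-resp-⊆ (c ∷ʳ σ) r = later (Before-resp-⊆ σ r)
  Before-resp-⊆ (refl ∷ σ) (first b∈) = first (lookup σ b∈)
  Before-resp-⊆ (refl ∷ σ) (later r) = later (Before-resp-⊆ σ r)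

  ⊆-insert : ∀ p → p ++ q ⊆ p ++ c ∷ q
  ⊆-insert {c = c} p = Sublist.++⁺ (⊆-refl {x = p}) (c ∷ʳ ⊆-refl)

  ∈-delete : ∀ p → a ∈ p ++ c ∷ q → a ≢ c → a ∈ p ++ q
  ∈-delete p a∈ a≢c with ∈-++⁻ p a∈
  ... | inj₁ a∈p = ∈-++⁺ˡ a∈p
  ... | inj₂ (here refl) = ⊥-elim (a≢c refl)
  ... | inj₂ (there a∈q) = ∈-++⁺ʳ p a∈q

  Before-delete : ∀ p → Before (p ++ c ∷ q) a b → a ≢ c → b ≢ c → Before (p ++ q) a b
  Before-delete [] (first _) a≢c _ = ⊥-elim (a≢c refl)
  Before-delete [] (later r) _ _ = r
  Before-delete (_ ∷ p) (first b∈) _ b≢c = first (∈-delete p b∈ b≢c)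
  Before-delete (_ ∷ p) (later r) a≢c b≢c = later (Before-delete p r a≢c b≢c)

  ∈-swap : ∀ p → a ∈ p ++ c ∷ d ∷ q → a ∈ p ++ d ∷ c ∷ q
  ∈-swap p = ∈-resp-↭ (↭.++⁺ˡ p (↭.swap _ _ ↭.refl))

  ∈-unshift : ∀ p → a ∈ c ∷ p ++ q → a ∈ p ++ c ∷ q
  ∈-unshift {c = c} {q = q} p = ∈-resp-↭ (↭.↭-sym (↭.shift c p q))

  ∈-shift : ∀ p → a ∈ p ++ c ∷ q → a ∈ c ∷ p ++ q
  ∈-shift {c = c} {q = q} p = ∈-resp-↭ (↭.shift c p q)

  ∈-∷⁻ : a ∈ c ∷ w → a ≢ c → a ∈ w
  ∈-∷⁻ (here refl) a≢c = ⊥-elim (a≢c refl)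
  ∈-∷⁻ (there a∈) _ = a∈

  Unique-middle⇒∉ : ∀ p → Unique (p ++ c ∷ q) → c ∉ p ++ q
  Unique-middle⇒∉ [] (c∉ ∷ _) c∈ = All.lookup c∉ c∈ refl
  Unique-middle⇒∉ (_ ∷ p) (a∉ ∷ _) (here refl) = All.lookup a∉ (∈-++⁺ʳ p (here refl)) refl
  Unique-middle⇒∉ (_ ∷ p) (_ ∷ u) (there c∈) = Unique-middle⇒∉ p u c∈

  Before-swap : ∀ p → Before (p ++ c ∷ d ∷ q) a b → a ≢ c ⊎ b ≢ d → Before (p ++ d ∷ c ∷ q) a b
  Before-swap [] (first (here refl)) (inj₁ a≢c) = ⊥-elim (a≢c refl)
  Before-swap [] (first (here refl)) (inj₂ b≢d) = ⊥-elim (b≢d refl)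
  Before-swap [] (first (there b∈)) _ = later (first b∈)
  Before-swap [] (later (first b∈)) _ = first (there b∈)
  Before-swap [] (later (later r)) _ = later (later r)
  Before-swap (_ ∷ p) (first b∈) _ = first (∈-swap p b∈)
  Before-swap (_ ∷ p) (later r) h = later (Before-swap p r h)

  Before-from-middle : ∀ p → Before (p ++ c ∷ q) c b → c ∉ p → b ∈ q
  Before-from-middle [] r _ = Before-∷⇒∈ʳ r
  Before-from-middle (_ ∷ p) (first _) c∉ = ⊥-elim (c∉ (here refl))
  Before-from-middle (_ ∷ p) (later r) c∉ = Before-from-middle p r (λ c∈ → c∉ (there c∈))

  Before-to-middle : ∀ p → Before (p ++ c ∷ q) a c → c ∉ q → a ∈ p
  Before-to-middle [] (first c∈) c∉ = ⊥-elim (c∉ c∈)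
  Before-to-middle [] (later r) c∉ = ⊥-elim (c∉ (Before⇒∈ʳ r))
  Before-to-middle (_ ∷ p) (first _) _ = here refl
  Before-to-middle (_ ∷ p) (later r) c∉ = there (Before-to-middle p r c∉)

  -- Greedy embedding: asymmetry of R on q forbids skipping an element of q that p still needs.
  AllPairs-∈⇒⊆ : (∀ {a b} → a ∈ q → b ∈ q → R a b → R b a → ⊥) →
                 AllPairs R p → AllPairs R q → (∀ {a} → a ∈ p → a ∈ q) → p ⊆ q
  AllPairs-∈⇒⊆ {q = q} {p = []} _ _ _ _ = minimum q
  AllPairs-∈⇒⊆ {q = []} {p = a ∷ p} _ _ _ ⊆q with ⊆q (here refl)
  ... | ()
  AllPairs-∈⇒⊆ {q = c ∷ q} {p = a ∷ p} asym (rp ∷ rps) (rq ∷ rqs) ⊆q with ⊆q (here refl)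
  ... | here refl = refl ∷ AllPairs-∈⇒⊆ (λ a∈ b∈ → asym (there a∈) (there b∈)) rps rqs tail
    where
    tail : ∀ {b} → b ∈ p → b ∈ q
    tail b∈ with ⊆q (there b∈)
    ... | here refl = ⊥-elim (asym (here refl) (here refl) (All.lookup rp b∈) (All.lookup rp b∈))
    ... | there b∈q = b∈q
  ... | there a∈q = c ∷ʳ AllPairs-∈⇒⊆ (λ a∈ b∈ → asym (there a∈) (there b∈)) (rp ∷ rps) rqs tail
    where
    tail : ∀ {b} → b ∈ a ∷ p → b ∈ q
    tail (here refl) = a∈q
    tail (there b∈) with ⊆q (there b∈)
    ... | here refl = ⊥-elim (asym (there a∈q) (here refl) (All.lookup rp b∈) (All.lookup rq a∈q))
    ... | there b∈q = b∈q

  AllPairs-resp-⊆ : p ⊆ q → AllPairs R q → AllPairs R p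
  AllPairs-resp-⊆ σ rq = Before⇒AllPairs (λ r → AllPairs-Before rq (Before-resp-⊆ σ r))

  Before-⊆⇒⊆ : Unique q → (∀ {a} → a ∈ p → a ∈ q) → (∀ {a b} → Before p a b → Before q a b) → p ⊆ q
  Before-⊆⇒⊆ uq p⊆q before =
    AllPairs-∈⇒⊆ (λ _ _ → Before-asym uq) (Before⇒AllPairs before) (Before⇒AllPairs (λ r → r)) p⊆q

  Before-⊆⇒≡ : Unique p → Unique q → (∀ {a} → a ∈ p → a ∈ q) → (∀ {a} → a ∈ q → a ∈ p) →
               (∀ {a b} → Before p a b → Before q a b) → p ≡ q
  Before-⊆⇒≡ {p = p} {q = q} up uq p⊆q q⊆p before =
    ⊆-antisym (Before-⊆⇒⊆ uq p⊆q before) (Before-⊆⇒⊆ up q⊆p reflect)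
    where
    reflect : ∀ {a b} → Before q a b → Before p a b
    reflect r with Before-connex (q⊆p (Before⇒∈ˡ r)) (q⊆p (Before⇒∈ʳ r)) (λ { refl → Before-irrefl uq r })
    ... | inj₁ r′ = r′
    ... | inj₂ r′ = ⊥-elim (Before-asym uq r (before r′))

  ⊆-Unique⇒≡ : Unique w → p ⊆ w → q ⊆ w →
               (∀ {a} → a ∈ p → a ∈ q) → (∀ {a} → a ∈ q → a ∈ p) → p ≡ q
  ⊆-Unique⇒≡ {p = p} {q = q} uw σ τ p⊆q q⊆p =
    Before-⊆⇒≡ (AllPairs-resp-⊆ σ uw) (AllPairs-resp-⊆ τ uw) p⊆q q⊆p before
    where
    before : ∀ {a b} → Before p a b → Before q a b
    before r with Before-connex (p⊆q (Before⇒∈ˡ r)) (p⊆q (Before⇒∈ʳ r))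
                    (λ { refl → Before-irrefl uw (Before-resp-⊆ σ r) })
    ... | inj₁ r′ = r′
    ... | inj₂ r′ = ⊥-elim (Before-asym uw (Before-resp-⊆ σ r) (Before-resp-⊆ τ r′))

  Before-filter⁺ : {P : A → Set} (P? : U.Decidable P) → Before w a b → P a → P b → Before (filter P? w) a b
  Before-filter⁺ {w = c ∷ _} P? r pa pb with P? c
  Before-filter⁺ P? (first b∈) _ pb | yes _ = first (∈-filter⁺ P? b∈ pb)
  Before-filter⁺ P? (later r) pa pb | yes _ = later (Before-filter⁺ P? r pa pb)
  Before-filter⁺ P? (first _) pa _ | no ¬pa = ⊥-elim (¬pa pa)
  Before-filter⁺ P? (later r) pa pb | no _ = Before-filter⁺ P? r pa pb

allFin-sorted : ∀ k → AllPairs _<_ (allFin k)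
allFin-sorted _ = AllPairs.tabulate⁺-< (λ i<j → i<j)

module _ {m n : ℕ} where

  private
    variable
      a b c : Letter m n
      p q w : Word m n
      s s′ : Fin m
      t t′ k : Fin n
      u v z : Word m n
      N : ℕ

  ∈-restrict⁺ : a ∈ w → a ∈ v → a ∈ restrict w v
  ∈-restrict⁺ {v = v} = ∈-filter⁺ (_∈? v)

  ∈-restrict⁻ : a ∈ restrict w v → a ∈ w × a ∈ v
  ∈-restrict⁻ {w = w} {v = v} = ∈-filter⁻ (_∈? v) {xs = w}

  Before-restrict⁺ : Before w a b → a ∈ v → b ∈ v → Before (restrict w v) a b
  Before-restrict⁺ {v = v} = Before-filter⁺ (_∈? v)

  Before-restrict⁻ : Before (restrict w v) a b → Before w a b
  Before-restrict⁻ {w = w} {v = v} = Before-resp-⊆ (Sublist.filter-⊆ (_∈? v) w)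

  xl∈xword : xl s ∈ xword {m} {n}
  xl∈xword {s = s} = ∈-map⁺ xl (∈-allFin s)

  yl∈yword : yl t ∈ yword {m} {n}
  yl∈yword {t = t} = ∈-map⁺ yl (∈-allFin t)

  -- Shuffles as sorted words

  InOrder : Letter m n → Letter m n → Set
  InOrder (xl s) (xl s′) = s < s′
  InOrder (yl t) (yl t′) = t < t′
  InOrder _ _ = ⊤

  Sorted : Word m n → Set
  Sorted = AllPairs InOrder

  InOrder-irrefl : ¬ InOrder a a
  InOrder-irrefl {a = xl _} = Fin.<-irrefl refl
  InOrder-irrefl {a = yl _} = Fin.<-irrefl refl

  Sorted⇒Unique : Sorted w → Unique w
  Sorted⇒Unique = AllPairs.map λ { ab refl → InOrder-irrefl ab }

  xword-sorted : Sorted (xword {m} {n})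
  xword-sorted = AllPairs.map⁺ (allFin-sorted m)

  yword-sorted : Sorted (yword {m} {n})
  yword-sorted = AllPairs.map⁺ (allFin-sorted n)

  InOrder-asym-xword : a ∈ xword {m} {n} → b ∈ xword → InOrder a b → InOrder b a → ⊥
  InOrder-asym-xword a∈ b∈ with ∈-map⁻ xl a∈ | ∈-map⁻ xl b∈
  ... | _ , _ , refl | _ , _ , refl = Fin.<-asym

  InOrder-asym-yword : a ∈ yword {m} {n} → b ∈ yword → InOrder a b → InOrder b a → ⊥
  InOrder-asym-yword a∈ b∈ with ∈-map⁻ yl a∈ | ∈-map⁻ yl b∈
  ... | _ , _ , refl | _ , _ , refl = Fin.<-asym

  Shuf⇒Sorted : Shuf w → Sorted w
  Shuf⇒Sorted {w = w} (_ , xs⊆ , ys⊆) = Before⇒AllPairs inOrder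
    where
    inOrder : ∀ {a b} → Before w a b → InOrder a b
    inOrder {a = xl _} {b = xl _} r =
      AllPairs-Before xword-sorted (Before-resp-⊆ xs⊆ (Before-restrict⁺ r xl∈xword xl∈xword))
    inOrder {a = yl _} {b = yl _} r =
      AllPairs-Before yword-sorted (Before-resp-⊆ ys⊆ (Before-restrict⁺ r yl∈yword yl∈yword))
    inOrder {a = xl _} {b = yl _} _ = tt
    inOrder {a = yl _} {b = xl _} _ = tt

  Sorted⇒Shuf : Sorted w → Shuf w
  Sorted⇒Shuf {w = w} sw =
      Sorted⇒Unique sw
    , AllPairs-∈⇒⊆ InOrder-asym-xword (AllPairs.filter⁺ (_∈? xword) sw) xword-sorted
        (λ a∈ → proj₂ (∈-restrict⁻ {w = w} a∈))
    , AllPairs-∈⇒⊆ InOrder-asym-yword (AllPairs.filter⁺ (_∈? yword) sw) yword-sorted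
        (λ a∈ → proj₂ (∈-restrict⁻ {w = w} a∈))

  -- The bubble order via inversion data

  -- Some y_k with t ≤ k precedes x_s in w: Inv(w) closed downwards in the Y-index.
  data Inv↓ (w : Word m n) (s : Fin m) (t : Fin n) : Set where
    inv↓ : t ≤ k → Before w (yl k) (xl s) → Inv↓ w s t

  Inv⇔Before : Inv w s t ⇔ Before w (yl t) (xl s)
  Inv⇔Before = mk⇔ (λ { (_ , _ , refl , y∈ , x∈) → Before-++ y∈ x∈ }) Before⇒++

  Before⇒Inv↓ : Before w (yl t) (xl s) → Inv↓ w s t
  Before⇒Inv↓ = inv↓ Fin.≤-refl

  Inv↓-≤ : t ≤ t′ → Inv↓ w s t′ → Inv↓ w s t
  Inv↓-≤ t≤t′ (inv↓ t′≤k r) = inv↓ (Fin.≤-trans t≤t′ t′≤k) r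

  Inv↓⇒∈ : Inv↓ w s t → xl s ∈ w
  Inv↓⇒∈ (inv↓ _ r) = Before⇒∈ʳ r

  Inv↓⇒Before : Sorted w → yl t ∈ w → Inv↓ w s t → Before w (yl t) (xl s)
  Inv↓⇒Before {t = t} sw y∈ (inv↓ {k = k} t≤k r) with t Fin.≟ k
  ... | yes refl = r
  ... | no t≢k with Before-connex y∈ (Before⇒∈ˡ r) (λ { refl → t≢k refl })
  ...   | inj₁ r′ = Before-trans (Sorted⇒Unique sw) r′ r
  ...   | inj₂ r′ = ⊥-elim (ℕ.<⇒≱ (AllPairs-Before sw r′) t≤k)

  Inv↓-monoˡ : Sorted w → xl s′ ∈ w → s < s′ → Inv↓ w s t → Inv↓ w s′ t
  Inv↓-monoˡ sw x∈ s<s′ (inv↓ t≤k r)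
    with Before-connex (Before⇒∈ʳ r) x∈ (λ { refl → Fin.<-irrefl refl s<s′ })
  ... | inj₁ r′ = inv↓ t≤k (Before-trans (Sorted⇒Unique sw) r r′)
  ... | inj₂ r′ = ⊥-elim (Fin.<-asym s<s′ (AllPairs-Before sw r′))

  Sorted-swap : ∀ p → Sorted (p ++ xl s ∷ yl t ∷ q) → Sorted (p ++ yl t ∷ xl s ∷ q)
  Sorted-swap {s = s} {t = t} {q = q} p sw = Before⇒AllPairs inOrder
    where
    inOrder : ∀ {a b} → Before (p ++ yl t ∷ xl s ∷ q) a b → InOrder a b
    inOrder {a} {b} r with a ≟L yl t | b ≟L xl s
    ... | yes refl | yes refl = tt
    ... | no a≢yt | _ = AllPairs-Before sw (Before-swap p r (inj₁ a≢yt))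
    ... | yes refl | no b≢xs = AllPairs-Before sw (Before-swap p r (inj₂ b≢xs))

  record _⊑_ (u z : Word m n) : Set where
    field
      x-⊇ : ∀ {s} → xl s ∈ z → xl s ∈ u
      y-⊆ : ∀ {t} → yl t ∈ u → yl t ∈ z
      inv↓-⊆ : ∀ {s t} → xl s ∈ z → Inv↓ u s t → Inv↓ z s t
  open _⊑_

  ⊑-refl : u ⊑ u
  ⊑-refl = record { x-⊇ = λ x∈ → x∈ ; y-⊆ = λ y∈ → y∈ ; inv↓-⊆ = λ _ i → i }

  ⊑-trans : u ⊑ v → v ⊑ z → u ⊑ z
  ⊑-trans u⊑v v⊑z = record
    { x-⊇ = λ x∈ → x-⊇ u⊑v (x-⊇ v⊑z x∈)
    ; y-⊆ = λ y∈ → y-⊆ v⊑z (y-⊆ u⊑v y∈)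
    ; inv↓-⊆ = λ x∈ i → inv↓-⊆ v⊑z x∈ (inv↓-⊆ u⊑v (x-⊇ v⊑z x∈) i)
    }

  -- No move deletes a Y-letter, inserts an X-letter, or moves a Y-letter to the right of an X-letter.
  Move⇒⊑ : Sorted u → Move u z → u ⊑ z
  Move⇒⊑ su (del p q s) = record
    { x-⊇ = lookup (⊆-insert p)
    ; y-⊆ = λ y∈ → ∈-delete p y∈ (λ ())
    ; inv↓-⊆ = λ { x∈ (inv↓ t≤k r) →
        inv↓ t≤k (Before-delete p r (λ ()) (λ { refl → Unique-middle⇒∉ p (Sorted⇒Unique su) x∈ })) }
    }
  Move⇒⊑ _ (ins p q t) = record
    { x-⊇ = λ x∈ → ∈-delete p x∈ (λ ())
    ; y-⊆ = lookup (⊆-insert p)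
    ; inv↓-⊆ = λ { _ (inv↓ t≤k r) → inv↓ t≤k (Before-resp-⊆ (⊆-insert p) r) }
    }
  Move⇒⊑ _ (swap p q s t) = record
    { x-⊇ = ∈-swap p
    ; y-⊆ = ∈-swap p
    ; inv↓-⊆ = λ { _ (inv↓ t≤k r) → inv↓ t≤k (Before-swap p r (inj₁ (λ ()))) }
    }

  ≤bub⇒⊑ : u ≤bub z → u ⊑ z
  ≤bub⇒⊑ ε = ⊑-refl
  ≤bub⇒⊑ ((su , _ , mv) ◅ rest) = ⊑-trans (Move⇒⊑ (Shuf⇒Sorted su) mv) (≤bub⇒⊑ rest)

  Move⇒≤bub : Sorted u → Sorted z → Move u z → u ≤bub z
  Move⇒≤bub su sz mv = (Sorted⇒Shuf su , Sorted⇒Shuf sz , mv) ◅ ε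

  ≤bub-sorted : u ≤bub z → Sorted u → Sorted z
  ≤bub-sorted ε su = su
  ≤bub-sorted ((_ , sv , _) ◅ rest) _ = ≤bub-sorted rest (Shuf⇒Sorted sv)

  Move-∷ : Move u z → Move (c ∷ u) (c ∷ z)
  Move-∷ {c = c} (del p q s) = del (c ∷ p) q s
  Move-∷ {c = c} (ins p q t) = ins (c ∷ p) q t
  Move-∷ {c = c} (swap p q s t) = swap (c ∷ p) q s t

  -- Along a path from u to z, X-letters only disappear and Y-letters only appear,
  -- so every intermediate letter already follows c in c ∷ u or in c ∷ z.
  Sorted-∷-between : Sorted (c ∷ u) → Sorted (c ∷ z) → u ⊑ v → v ⊑ z → Sorted v → Sorted (c ∷ v)
  Sorted-∷-between {c = c} {v = v} (cu ∷ _) (cz ∷ _) u⊑v v⊑z sv = All.tabulate inOrder ∷ sv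
    where
    inOrder : ∀ {e} → e ∈ v → InOrder c e
    inOrder {xl _} e∈ = All.lookup cu (x-⊇ u⊑v e∈)
    inOrder {yl _} e∈ = All.lookup cz (y-⊆ v⊑z e∈)

  ≤bub-∷ : u ≤bub z → Sorted (c ∷ u) → Sorted (c ∷ z) → (c ∷ u) ≤bub (c ∷ z)
  ≤bub-∷ ε _ _ = ε
  ≤bub-∷ ((su , sv , mv) ◅ rest) scu scz = Move⇒≤bub scu scv (Move-∷ mv) ◅◅ ≤bub-∷ rest scv scz
    where
    scv = Sorted-∷-between scu scz (Move⇒⊑ (Shuf⇒Sorted su) mv) (≤bub⇒⊑ rest) (Shuf⇒Sorted sv)

  IsX : Letter m n → Set
  IsX (xl _) = ⊤
  IsX (yl _) = ⊥

  bubble : ∀ p → All IsX p → Sorted (p ++ yl t ∷ q) → (p ++ yl t ∷ q) ≤bub (yl t ∷ p ++ q)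
  bubble [] _ _ = ε
  bubble {t = t} {q = q} (xl s ∷ p) (_ ∷ isX) (s≺ ∷ sorted) =
    ≤bub-∷ inner (s≺ ∷ sorted) swapped ◅◅ Move⇒≤bub swapped (Sorted-swap [] swapped) (swap [] (p ++ q) s t)
    where
    inner = bubble p isX sorted
    swapped : Sorted (xl s ∷ yl t ∷ p ++ q)
    swapped = All.tabulate (λ e∈ → All.lookup s≺ (∈-unshift p e∈)) ∷ ≤bub-sorted inner sorted

  Inv↓-∷⁻ : Sorted (c ∷ z) → yl k ∈ z → Inv↓ (c ∷ z) s k → Inv↓ z s k
  Inv↓-∷⁻ _ _ (inv↓ k≤k′ (later r)) = inv↓ k≤k′ r
  Inv↓-∷⁻ (k′≺ ∷ _) y∈ (inv↓ k≤k′ (first _)) = ⊥-elim (ℕ.<⇒≱ (All.lookup k′≺ y∈) k≤k′)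

  ⊑-∷ˡ⁻ : (c ∷ u) ⊑ z → c ∉ z → u ⊑ z
  ⊑-∷ˡ⁻ cu⊑z c∉z = record
    { x-⊇ = λ x∈ → ∈-∷⁻ (x-⊇ cu⊑z x∈) (λ { refl → c∉z x∈ })
    ; y-⊆ = λ y∈ → y-⊆ cu⊑z (there y∈)
    ; inv↓-⊆ = λ { x∈ (inv↓ t≤k r) → inv↓-⊆ cu⊑z x∈ (inv↓ t≤k (later r)) }
    }

  ⊑-∷ʳ⁻ : Sorted (yl t ∷ z) → u ⊑ (yl t ∷ z) → yl t ∉ u → u ⊑ z
  ⊑-∷ʳ⁻ {t = t} {z = z} {u = u} sz u⊑tz t∉u = record
    { x-⊇ = λ x∈ → x-⊇ u⊑tz (there x∈)
    ; y-⊆ = y-⊆′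
    ; inv↓-⊆ = λ { x∈ (inv↓ t≤k r) →
        Inv↓-≤ t≤k (Inv↓-∷⁻ sz (y-⊆′ (Before⇒∈ˡ r)) (inv↓-⊆ u⊑tz (there x∈) (Before⇒Inv↓ r))) }
    }
    where
    y-⊆′ : ∀ {t′} → yl t′ ∈ u → yl t′ ∈ z
    y-⊆′ y∈ = ∈-∷⁻ (y-⊆ u⊑tz y∈) (λ { refl → t∉u y∈ })

  ⊑-∷⁻ : Sorted (c ∷ u) → Sorted (c ∷ z) → (c ∷ u) ⊑ (c ∷ z) → u ⊑ z
  ⊑-∷⁻ {c = c} {u = u} {z = z} scu scz h = record
    { x-⊇ = λ x∈ → ∈-∷⁻ (x-⊇ h (there x∈)) (λ { refl → Unique[x∷xs]⇒x∉xs (Sorted⇒Unique scz) x∈ })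
    ; y-⊆ = y-⊆′
    ; inv↓-⊆ = λ { x∈ (inv↓ t≤k r) →
        Inv↓-≤ t≤k (Inv↓-∷⁻ scz (y-⊆′ (Before⇒∈ˡ r)) (inv↓-⊆ h (there x∈) (Before⇒Inv↓ (later r)))) }
    }
    where
    y-⊆′ : ∀ {t} → yl t ∈ u → yl t ∈ z
    y-⊆′ y∈ = ∈-∷⁻ (y-⊆ h (there y∈)) (λ { refl → Unique[x∷xs]⇒x∉xs (Sorted⇒Unique scu) y∈ })

  -- The y_t at the head of the target precedes every X-letter there, so bubbling y_t to the front is harmless.
  ⊑-bubble : ∀ p → (p ++ yl t ∷ q) ⊑ (yl t ∷ z) → (yl t ∷ p ++ q) ⊑ (yl t ∷ z)
  ⊑-bubble p h = record
    { x-⊇ = λ x∈ → ∈-shift p (x-⊇ h x∈)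
    ; y-⊆ = λ y∈ → y-⊆ h (∈-unshift p y∈)
    ; inv↓-⊆ = λ
        { x∈ (inv↓ t≤k (first _)) → inv↓ t≤k (first (∈-∷⁻ x∈ (λ ())))
        ; x∈ (inv↓ t≤k (later r)) → inv↓-⊆ h x∈ (inv↓ t≤k (Before-resp-⊆ (⊆-insert p) r))
        }
    }

  ⊑-head-bubbles : ∀ p → Sorted (p ++ yl t ∷ q) → Sorted (yl t ∷ z) → (p ++ yl t ∷ q) ⊑ (yl t ∷ z) → All IsX p
  ⊑-head-bubbles {t = t} p su (t≺ ∷ _) h = All.tabulate isX
    where
    isX : ∀ {e} → e ∈ p → IsX e
    isX {xl _} _ = tt
    isX {yl _} e∈ with y-⊆ h (∈-++⁺ˡ e∈)
    ... | here refl = Fin.<-irrefl refl (AllPairs-Before su (Before-++ e∈ (here refl)))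
    ... | there k∈ = Fin.<-asym (AllPairs-Before su (Before-++ e∈ (here refl))) (All.lookup t≺ k∈)

  ⊑⇒≤bub-Upto : ℕ → Set
  ⊑⇒≤bub-Upto N = ∀ {u z : Word m n} → length u + length z ℕ.≤ N → Sorted u → Sorted z → u ⊑ z → u ≤bub z

  delete-head : ⊑⇒≤bub-Upto N → length (xl s ∷ u) + length z ℕ.≤ suc N →
                Sorted (xl s ∷ u) → Sorted z → (xl s ∷ u) ⊑ z → xl s ∉ z → (xl s ∷ u) ≤bub z
  delete-head {s = s} {u = u} rec bound su sz h s∉z =
    Move⇒≤bub su (AllPairs.tail su) (del [] u s) ◅◅ rec (ℕ.≤-pred bound) (AllPairs.tail su) sz (⊑-∷ˡ⁻ h s∉z)

  insert-head : ⊑⇒≤bub-Upto N → length u + length (yl t ∷ z) ℕ.≤ suc N →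
                Sorted u → Sorted (yl t ∷ z) → u ⊑ (yl t ∷ z) → yl t ∉ u → u ≤bub (yl t ∷ z)
  insert-head {N = N} {u = u} {t = t} {z = z} rec bound su sz h t∉u =
    rec bound′ su (AllPairs.tail sz) (⊑-∷ʳ⁻ sz h t∉u) ◅◅ Move⇒≤bub (AllPairs.tail sz) sz (ins [] z t)
    where
    bound′ : length u + length z ℕ.≤ N
    bound′ = ℕ.≤-pred (subst (ℕ._≤ suc N) (ℕ.+-suc (length u) (length z)) bound)

  common-head : ⊑⇒≤bub-Upto N → length (c ∷ u) + length (c ∷ z) ℕ.≤ suc N →
                Sorted (c ∷ u) → Sorted (c ∷ z) → (c ∷ u) ⊑ (c ∷ z) → (c ∷ u) ≤bub (c ∷ z)
  common-head {u = u} {z = z} rec bound scu scz h =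
    ≤bub-∷ (rec bound′ (AllPairs.tail scu) (AllPairs.tail scz) (⊑-∷⁻ scu scz h)) scu scz
    where
    bound′ = ℕ.≤-trans (ℕ.+-monoʳ-≤ (length u) (ℕ.n≤1+n (length z))) (ℕ.≤-pred bound)

  bubble-head : ⊑⇒≤bub-Upto N → length u + length (yl t ∷ z) ℕ.≤ suc N →
                Sorted u → Sorted (yl t ∷ z) → u ⊑ (yl t ∷ z) → yl t ∈ u → u ≤bub (yl t ∷ z)
  bubble-head {N = N} {t = t} {z = z} rec bound su sz h t∈u with ∈-∃++ t∈u
  ... | p , q , refl = path ◅◅ common-head rec bound′ (≤bub-sorted path su) sz (⊑-bubble p h)
    where
    path = bubble p (⊑-head-bubbles p su sz h) su
    bound′ : length (yl t ∷ p ++ q) + length (yl t ∷ z) ℕ.≤ suc N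
    bound′ = subst (λ ℓ → ℓ + length (yl t ∷ z) ℕ.≤ suc N) (↭.↭-length (↭.shift (yl t) p q)) bound

  xl-head : ⊑⇒≤bub-Upto N → length (xl s ∷ u) + length z ℕ.≤ suc N →
           Sorted (xl s ∷ u) → Sorted z → (xl s ∷ u) ⊑ z → xl s ∈ z → (xl s ∷ u) ≤bub z
  xl-head {s = s} {z = xl s′ ∷ z} rec bound su sz h s∈z with s Fin.≟ s′
  ... | yes refl = common-head rec bound su sz h
  ... | no s≢s′ = ⊥-elim (Fin.<-asym (All.lookup (AllPairs.head su) s′∈u) (All.lookup (AllPairs.head sz) s∈z′))
    where
    s′∈u = ∈-∷⁻ (x-⊇ h (here refl)) (λ { refl → s≢s′ refl })
    s∈z′ = ∈-∷⁻ s∈z (λ { refl → s≢s′ refl })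
  xl-head {s = s} {u = u} {z = yl t ∷ z} rec bound su sz h s∈z with yl t ∈? (xl s ∷ u)
  ... | no t∉u = insert-head rec bound su sz h t∉u
  ... | yes t∈u = bubble-head rec bound su sz h t∈u

  yl-head : ⊑⇒≤bub-Upto N → length (yl t ∷ u) + length z ℕ.≤ suc N →
           Sorted (yl t ∷ u) → Sorted z → (yl t ∷ u) ⊑ z → (yl t ∷ u) ≤bub z
  yl-head {z = []} _ _ _ _ h with y-⊆ h (here refl)
  ... | ()
  yl-head {t = t} {u = u} {z = yl t′ ∷ z} rec bound su sz h with yl t′ ∈? (yl t ∷ u) | t Fin.≟ t′
  ... | no t′∉u | _ = insert-head rec bound su sz h t′∉u
  ... | yes _ | yes refl = common-head rec bound su sz h
  ... | yes t′∈u | no t≢t′ =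
    ⊥-elim (Fin.<-asym (All.lookup (AllPairs.head su) t′∈u′) (All.lookup (AllPairs.head sz) t∈z))
    where
    t′∈u′ = ∈-∷⁻ t′∈u (λ { refl → t≢t′ refl })
    t∈z = ∈-∷⁻ (y-⊆ h (here refl)) (λ { refl → t≢t′ refl })
  yl-head {t = t} {z = xl s ∷ z} _ _ su sz h
    with inv↓-⊆ h (here refl) (Before⇒Inv↓ (first (∈-∷⁻ (x-⊇ h (here refl)) (λ ()))))
  ... | inv↓ _ (later r) = ⊥-elim (Unique[x∷xs]⇒x∉xs (Sorted⇒Unique sz) (Before⇒∈ʳ r))

  -- Compare first letters: an X-head of u absent from z is deleted, a Y-head of z absent from u is
  -- inserted last, equal heads are peeled off, and a Y-head of z occurring in u is bubbled forward.
  ⊑⇒≤bub-upto : ∀ N → ⊑⇒≤bub-Upto N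
  ⊑⇒≤bub-upto zero {[]} {[]} _ _ _ _ = ε
  ⊑⇒≤bub-upto (suc N) {[]} {[]} _ _ _ _ = ε
  ⊑⇒≤bub-upto (suc N) {[]} {xl s ∷ z} _ _ _ h with x-⊇ h (here refl)
  ... | ()
  ⊑⇒≤bub-upto (suc N) {[]} {yl t ∷ z} bound su sz h =
    insert-head (⊑⇒≤bub-upto N) bound su sz h (λ ())
  ⊑⇒≤bub-upto (suc N) {xl s ∷ u} {z} bound su sz h with xl s ∈? z
  ... | no s∉z = delete-head (⊑⇒≤bub-upto N) bound su sz h s∉z
  ... | yes s∈z = xl-head (⊑⇒≤bub-upto N) bound su sz h s∈z
  ⊑⇒≤bub-upto (suc N) {yl t ∷ u} bound su sz h = yl-head (⊑⇒≤bub-upto N) bound su sz h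

  ⊑⇒≤bub : Sorted u → Sorted z → u ⊑ z → u ≤bub z
  ⊑⇒≤bub = ⊑⇒≤bub-upto _ ℕ.≤-refl

  -- The y-filling

  record Inv↓Extension (w f : Word m n) : Set where
    field
      sorted : Sorted f
      ⊇-letters : ∀ {c} → c ∈ w → c ∈ f
      inv↓⁺ : ∀ {s t} → Inv↓ w s t → Inv↓ f s t
      inv↓⁻ : ∀ {s t} → Inv↓ f s t → Inv↓ w s t
  open Inv↓Extension

  Inv↓Extension-refl : Sorted w → Inv↓Extension w w
  Inv↓Extension-refl sw = record { sorted = sw ; ⊇-letters = λ c∈ → c∈ ; inv↓⁺ = λ i → i ; inv↓⁻ = λ i → i }

  Inv↓Extension-trans : Inv↓Extension u v → Inv↓Extension v z → Inv↓Extension u z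
  Inv↓Extension-trans u◁v v◁z = record
    { sorted = sorted v◁z
    ; ⊇-letters = λ c∈ → ⊇-letters v◁z (⊇-letters u◁v c∈)
    ; inv↓⁺ = λ i → inv↓⁺ v◁z (inv↓⁺ u◁v i)
    ; inv↓⁻ = λ i → inv↓⁻ u◁v (inv↓⁻ v◁z i)
    }

  -- By `covered`, every X-letter after y_j already follows some y_k with j ≤ k, so Inv↓ is unchanged.
  insert-y : ∀ (j : Fin n) p q → Sorted (p ++ q) →
             (∀ {k} → yl k ∈ p → k < j) → (∀ {k} → yl k ∈ q → j < k) → (∀ {s} → xl s ∈ q → Inv↓ q s j) →
             Inv↓Extension (p ++ q) (p ++ yl j ∷ q)
  insert-y j p q spq below above covered = record
    { sorted = Before⇒AllPairs inOrder
    ; ⊇-letters = lookup (⊆-insert p)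
    ; inv↓⁺ = λ { (inv↓ t≤k r) → inv↓ t≤k (Before-resp-⊆ (⊆-insert p) r) }
    ; inv↓⁻ = inv↓⁻′
    }
    where
    j∉p : yl j ∉ p
    j∉p j∈ = Fin.<-irrefl refl (below j∈)
    j∉q : yl j ∉ q
    j∉q j∈ = Fin.<-irrefl refl (above j∈)
    beforeJ : ∀ {a} → a ∈ p → InOrder a (yl j)
    beforeJ {xl _} _ = tt
    beforeJ {yl _} a∈ = below a∈
    afterJ : ∀ {b} → b ∈ q → InOrder (yl j) b
    afterJ {xl _} _ = tt
    afterJ {yl _} b∈ = above b∈
    inOrder : ∀ {a b} → Before (p ++ yl j ∷ q) a b → InOrder a b
    inOrder {a} {b} r with a ≟L yl j | b ≟L yl j
    ... | yes refl | yes refl = ⊥-elim (j∉q (Before-from-middle p r j∉p))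
    ... | yes refl | no _ = afterJ (Before-from-middle p r j∉p)
    ... | no _ | yes refl = beforeJ (Before-to-middle p r j∉q)
    ... | no a≢j | no b≢j = AllPairs-Before spq (Before-delete p r a≢j b≢j)
    inv↓⁻′ : ∀ {s t} → Inv↓ (p ++ yl j ∷ q) s t → Inv↓ (p ++ q) s t
    inv↓⁻′ (inv↓ {k = k} t≤k r) with k Fin.≟ j
    ... | no k≢j = inv↓ t≤k (Before-delete p r (λ { refl → k≢j refl }) (λ ()))
    ... | yes refl with covered (Before-from-middle p r j∉p)
    ...   | inv↓ j≤k′ r′ = inv↓ (Fin.≤-trans t≤k j≤k′) (Before-resp-⊆ (Sublist.++⁺ˡ p ⊆-refl) r′)

  nextY≡just⇒ : ∀ {j} → nextY j w ≡ just k →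
                j < k × yl k ∈ w × (∀ {k′} → j < k′ → yl k′ ∈ w → k ≤ k′)
  nextY≡just⇒ {w = w} {j = j} eq with filter (λ k → (j Fin.<? k) ×-dec (yl k ∈? w)) (allFin n) in eqF
  nextY≡just⇒ {w = w} {j = j} refl | k ∷ later-ks = proj₁ found , proj₂ found , least
    where
    P? = λ k → (j Fin.<? k) ×-dec (yl {m} {n} k ∈? w)
    ∈-subst : ∀ {k′} → k′ ∈ k ∷ later-ks → k′ ∈ filter P? (allFin n)
    ∈-subst = subst (_ ∈_) (sym eqF)
    found : j < k × yl k ∈ w
    found = proj₂ (∈-filter⁻ P? {xs = allFin n} (∈-subst (here refl)))
    least : ∀ {k′} → j < k′ → yl k′ ∈ w → k ≤ k′
    least {k′} j<k′ k′∈ with subst (k′ ∈_) eqF (∈-filter⁺ P? (∈-allFin k′) (j<k′ , k′∈))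
    ... | here refl = Fin.≤-refl
    ... | there k′∈ks with subst (AllPairs _<_) eqF (AllPairs.filter⁺ P? (allFin-sorted n))
    ...   | k< ∷ _ = ℕ.<⇒≤ (All.lookup k< k′∈ks)

  nextY≡nothing⇒ : ∀ {j} → nextY j w ≡ nothing → ∀ {k′} → j < k′ → yl k′ ∉ w
  nextY≡nothing⇒ {w = w} {j = j} eq {k′} j<k′ k′∈
    with filter (λ k → (j Fin.<? k) ×-dec (yl k ∈? w)) (allFin n) in eqF
  nextY≡nothing⇒ {w = w} {j = j} refl {k′} j<k′ k′∈ | []
    with subst (k′ ∈_) eqF (∈-filter⁺ (λ k → (j Fin.<? k) ×-dec (yl {m} {n} k ∈? w)) (∈-allFin k′) (j<k′ , k′∈))
  ... | ()

  insertLeftOf-split : b ∈ w → ∃[ p ] ∃[ q ] (w ≡ p ++ b ∷ q × insertLeftOf a b w ≡ p ++ a ∷ b ∷ q)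
  insertLeftOf-split {b = b} {w = c ∷ w} {a = a} b∈ with c ≟L b
  ... | yes refl = [] , w , refl , refl
  ... | no c≢b with insertLeftOf-split {a = a} (∈-∷⁻ b∈ (λ { refl → c≢b refl }))
  ...   | p , q , refl , inserted = c ∷ p , q , refl , cong (c ∷_) inserted

  fillStep-spec : ∀ j → Sorted w → Inv↓Extension w (fillStep j w) × yl j ∈ fillStep j w
  fillStep-spec {w = w} j sw with yl j ∈? w
  ... | yes j∈ = Inv↓Extension-refl sw , j∈
  ... | no j∉ with nextY j w in eq
  ...   | nothing =
    subst (λ w′ → Inv↓Extension w′ (w ++ [ yl j ])) (List.++-identityʳ w)
      (insert-y j w [] (subst Sorted (sym (List.++-identityʳ w)) sw) below (λ ()) (λ ()))
    , ∈-++⁺ʳ w (here refl)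
    where
    below : ∀ {k′} → yl k′ ∈ w → k′ < j
    below k′∈ = Fin.≤∧≢⇒< (ℕ.≮⇒≥ (λ j<k′ → nextY≡nothing⇒ eq j<k′ k′∈)) (λ { refl → j∉ k′∈ })
  ...   | just k with nextY≡just⇒ eq
  ...     | j<k , k∈ , least with insertLeftOf-split {a = yl j} k∈
  ...       | p , q , refl , inserted rewrite inserted =
    insert-y j p (yl k ∷ q) sw below above covered , ∈-++⁺ʳ p (here refl)
    where
    below : ∀ {k′} → yl k′ ∈ p → k′ < j
    below k′∈ = Fin.≤∧≢⇒< (ℕ.≮⇒≥ (λ j<k′ → ℕ.<⇒≱ k′<k (least j<k′ (∈-++⁺ˡ k′∈)))) (λ { refl → j∉ (∈-++⁺ˡ k′∈) })
      where
      k′<k = AllPairs-Before sw (Before-++ k′∈ (here refl))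
    above : ∀ {k′} → yl k′ ∈ yl k ∷ q → j < k′
    above (here refl) = j<k
    above (there k′∈) = Fin.<-trans j<k (AllPairs-Before sw (Before-resp-⊆ (Sublist.++⁺ˡ p ⊆-refl) (first k′∈)))
    covered : ∀ {s} → xl s ∈ yl k ∷ q → Inv↓ (yl k ∷ q) s j
    covered x∈ = inv↓ (ℕ.<⇒≤ j<k) (first (∈-∷⁻ x∈ (λ ())))

  foldr-fillStep-spec : ∀ js → Sorted w →
                        Inv↓Extension w (foldr fillStep w js) × (∀ {j} → j ∈ js → yl j ∈ foldr fillStep w js)
  foldr-fillStep-spec [] sw = Inv↓Extension-refl sw , λ ()
  foldr-fillStep-spec (j ∷ js) sw with foldr-fillStep-spec js sw
  ... | ext , filled with fillStep-spec j (sorted ext)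
  ...   | ext′ , j∈ =
    Inv↓Extension-trans ext ext′ , λ { (here refl) → j∈ ; (there j∈js) → ⊇-letters ext′ (filled j∈js) }

  yFill-spec : Sorted u → Inv↓Extension u (yFill u) × (∀ {t} → yl t ∈ yFill u)
  yFill-spec su = proj₁ spec , proj₂ spec (∈-allFin _)
    where
    spec = foldr-fillStep-spec (allFin n) su

  -- The join

  Inv⇔Inv↓ : Sorted w → Inv w s t ⇔ (yl t ∈ w × Inv↓ w s t)
  Inv⇔Inv↓ sw = mk⇔
    (λ i → let r = to Inv⇔Before i in Before⇒∈ˡ r , Before⇒Inv↓ r)
    (λ (y∈ , i) → from Inv⇔Before (Inv↓⇒Before sw y∈ i))

  Inv-restrict : Sorted w → yl t ∈ w → Inv (restrict w v) s t ⇔ (yl t ∈ v × xl s ∈ v × Inv↓ w s t)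
  Inv-restrict {w = w} sw y∈ = mk⇔
    (λ i → let r = to Inv⇔Before i in
      proj₂ (∈-restrict⁻ {w = w} (Before⇒∈ˡ r)) , proj₂ (∈-restrict⁻ {w = w} (Before⇒∈ʳ r)) ,
      Before⇒Inv↓ (Before-restrict⁻ r))
    (λ (y∈v , x∈v , i) → from Inv⇔Before (Before-restrict⁺ (Inv↓⇒Before sw y∈ i) y∈v x∈v))

  xyWord : List (Fin m) → List (Fin n) → Word m n
  xyWord ss ts = map xl ss ++ map yl ts

  xl∈xyWord⇔ : ∀ {ss ts} → xl s ∈ xyWord ss ts ⇔ s ∈ ss
  xl∈xyWord⇔ {ss = ss} = mk⇔ index (λ s∈ → ∈-++⁺ˡ (∈-map⁺ xl s∈))
    where
    index : ∀ {s ts} → xl s ∈ xyWord ss ts → s ∈ ss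
    index x∈ with ∈-++⁻ (map xl ss) x∈
    ... | inj₁ x∈ss with ∈-map⁻ xl x∈ss
    ...   | _ , s∈ , refl = s∈
    index x∈ | inj₂ x∈ts with ∈-map⁻ yl x∈ts
    ...   | _ , _ , ()

  yl∈xyWord⇔ : ∀ {ss ts} → yl t ∈ xyWord ss ts ⇔ t ∈ ts
  yl∈xyWord⇔ {ss = ss} = mk⇔ index (λ t∈ → ∈-++⁺ʳ (map xl ss) (∈-map⁺ yl t∈))
    where
    index : ∀ {t ts} → yl t ∈ xyWord ss ts → t ∈ ts
    index y∈ with ∈-++⁻ (map xl ss) y∈
    ... | inj₂ y∈ts with ∈-map⁻ yl y∈ts
    ...   | _ , t∈ , refl = t∈
    index y∈ | inj₁ y∈ss with ∈-map⁻ xl y∈ss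
    ...   | _ , _ , ()

  xyWord-sorted : ∀ {ss ts} → AllPairs _<_ ss → AllPairs _<_ ts → Sorted (xyWord ss ts)
  xyWord-sorted sss sts = AllPairs.++⁺ (AllPairs.map⁺ sss) (AllPairs.map⁺ sts)
    (All.tabulate λ x∈ → All.tabulate λ y∈ → inOrder x∈ y∈)
    where
    inOrder : ∀ {a b} → a ∈ map xl _ → b ∈ map yl _ → InOrder a b
    inOrder x∈ y∈ with ∈-map⁻ xl x∈ | ∈-map⁻ yl y∈
    ... | _ , _ , refl | _ , _ , refl = tt

  -- merge ss ts interleaves x_{ss} and y_{ts}, putting y_t before x_s while Q s t; recursing on
  -- ss outside and on ts inside (insertX) keeps the recursion structural.
  module Merge {Q : Fin m → Fin n → Set} (Q? : ∀ s t → Dec (Q s t)) where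

    insertX : Fin m → (List (Fin n) → Word m n) → List (Fin n) → Word m n
    insertX s rest [] = xl s ∷ rest []
    insertX s rest (t ∷ ts) = if does (Q? s t) then yl t ∷ insertX s rest ts else xl s ∷ rest (t ∷ ts)

    merge : List (Fin m) → List (Fin n) → Word m n
    merge [] = map yl
    merge (s ∷ ss) = insertX s (merge ss)

    merge-↭ : ∀ ss ts → merge ss ts ↭.↭ xyWord ss ts
    merge-↭ [] ts = ↭.refl
    merge-↭ (s ∷ ss) = insertX-↭
      where
      insertX-↭ : ∀ ts → insertX s (merge ss) ts ↭.↭ xyWord (s ∷ ss) ts
      insertX-↭ [] = ↭.prep (xl s) (merge-↭ ss [])
      insertX-↭ (t ∷ ts) with Q? s t
      ... | yes _ =
        ↭.trans (↭.prep (yl t) (insertX-↭ ts)) (↭.↭-sym (↭.shift (yl t) (map xl (s ∷ ss)) (map yl ts)))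
      ... | no _ = ↭.prep (xl s) (merge-↭ ss (t ∷ ts))

    ∈-merge⇔ : ∀ {ss ts} → c ∈ merge ss ts ⇔ c ∈ xyWord ss ts
    ∈-merge⇔ {ss = ss} {ts} = mk⇔ (∈-resp-↭ (merge-↭ ss ts)) (∈-resp-↭ (↭.↭-sym (merge-↭ ss ts)))

    xl∈merge⇒ : ∀ {ss ts} → xl s ∈ merge ss ts → s ∈ ss
    xl∈merge⇒ {ss = ss} {ts} x∈ = to (xl∈xyWord⇔ {ts = ts}) (to (∈-merge⇔ {ss = ss}) x∈)

    yl∈merge⇒ : ∀ {ss ts} → yl t ∈ merge ss ts → t ∈ ts
    yl∈merge⇒ {ss = ss} {ts} y∈ = to (yl∈xyWord⇔ {ss = ss}) (to (∈-merge⇔ {ss = ss}) y∈)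

    merge-sorted : ∀ {ss ts} → AllPairs _<_ ss → AllPairs _<_ ts → Sorted (merge ss ts)
    merge-sorted {[]} _ sts = AllPairs.map⁺ sts
    merge-sorted {s ∷ ss} (s< ∷ sss) = insertX-sorted
      where
      xl-s-first : ∀ {ts e} → e ∈ merge ss ts → InOrder (xl s) e
      xl-s-first {ts} {xl _} e∈ = All.lookup s< (xl∈merge⇒ {ts = ts} e∈)
      xl-s-first {e = yl _} _ = tt
      insertX-sorted : ∀ {ts} → AllPairs _<_ ts → Sorted (insertX s (merge ss) ts)
      insertX-sorted {[]} [] = All.tabulate xl-s-first ∷ merge-sorted sss []
      insertX-sorted {t ∷ ts} (t< ∷ sts) with Q? s t
      ... | yes _ = All.tabulate yl-t-first ∷ insertX-sorted sts
        where
        yl-t-first : ∀ {e} → e ∈ insertX s (merge ss) ts → InOrder (yl t) e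
        yl-t-first {xl _} _ = tt
        yl-t-first {yl _} e∈ = All.lookup t< (yl∈merge⇒ {ss = s ∷ ss} e∈)
      ... | no _ = All.tabulate xl-s-first ∷ merge-sorted sss (t< ∷ sts)

    Before-merge⁻ : ∀ {ss ts} → AllPairs _<_ ss →
                    (∀ {s s′ t} → s ∈ ss → s′ ∈ ss → s < s′ → Q s t → Q s′ t) →
                    s ∈ ss → Before (merge ss ts) (yl k) (xl s) → Q s k
    Before-merge⁻ {ss = s₀ ∷ ss} {ts} (s₀< ∷ sss) mono = insertX-before {ts}
      where
      mono′ : ∀ {s s′ t} → s ∈ ss → s′ ∈ ss → s < s′ → Q s t → Q s′ t
      mono′ s∈ s′∈ = mono (there s∈) (there s′∈)
      skip : ∀ {ts s k} → s ∈ s₀ ∷ ss → Before (merge ss ts) (yl k) (xl s) → Q s k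
      skip {ts} (here refl) r = ⊥-elim (Fin.<-irrefl refl (All.lookup s₀< (xl∈merge⇒ {ts = ts} (Before⇒∈ʳ r))))
      skip (there s∈) r = Before-merge⁻ sss mono′ s∈ r
      insertX-before : ∀ {ts s k} → s ∈ s₀ ∷ ss → Before (insertX s₀ (merge ss) ts) (yl k) (xl s) → Q s k
      insertX-before {[]} s∈ (later r) = skip s∈ r
      insertX-before {t ∷ ts} s∈ r with Q? s₀ t
      insertX-before {t ∷ ts} (here refl) (first _) | yes q = q
      insertX-before {t ∷ ts} (there s∈) (first _) | yes q = mono (here refl) (there s∈) (All.lookup s₀< s∈) q
      insertX-before {t ∷ ts} s∈ (later r) | yes _ = insertX-before {ts} s∈ r
      insertX-before {t ∷ ts} s∈ (later r) | no _ = skip s∈ r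

    Before-merge⁺ : ∀ {ss ts} → AllPairs _<_ ts → (∀ {s t k} → Q s k → t ≤ k → Q s t) →
                    s ∈ ss → k ∈ ts → Q s k → Before (merge ss ts) (yl k) (xl s)
    Before-merge⁺ {ss = s₀ ∷ ss} sts down = insertX-before sts
      where
      insertX-before : ∀ {ts s k} → AllPairs _<_ ts → s ∈ s₀ ∷ ss → k ∈ ts → Q s k →
                       Before (insertX s₀ (merge ss) ts) (yl k) (xl s)
      insertX-before {t ∷ ts} (t< ∷ sts) s∈ k∈ q with Q? s₀ t
      insertX-before {t ∷ ts} _ s∈ (here refl) _ | yes _ =
        first (from (∈-merge⇔ {ss = s₀ ∷ ss}) (from (xl∈xyWord⇔ {ts = ts}) s∈))
      insertX-before {t ∷ ts} (_ ∷ sts) s∈ (there k∈) q | yes _ = later (insertX-before sts s∈ k∈ q)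
      insertX-before {t ∷ ts} _ (here refl) (here refl) q | no ¬q = ⊥-elim (¬q q)
      insertX-before {t ∷ ts} (t< ∷ _) (here refl) (there k∈) q | no ¬q =
        ⊥-elim (¬q (down q (ℕ.<⇒≤ (All.lookup t< k∈))))
      insertX-before {t ∷ ts} (t< ∷ sts) (there s∈) k∈ q | no _ = later (Before-merge⁺ (t< ∷ sts) down s∈ k∈ q)

  Before? : ∀ w a b → Dec (Before {Letter m n} w a b)
  Before? [] a b = no λ ()
  Before? (c ∷ w) a b with Before? w a b
  ... | yes r = yes (later r)
  ... | no ¬r with c ≟L a | b ∈? w
  ...   | yes refl | yes b∈ = yes (first b∈)
  ...   | yes refl | no b∉ = no λ { (first b∈) → b∉ b∈ ; (later r) → ¬r r }
  ...   | no c≢a | _ = no λ { (first _) → c≢a refl ; (later r) → ¬r r }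

  Inv↓? : ∀ w s t → Dec (Inv↓ w s t)
  Inv↓? w s t = Decidable.map′ (λ (_ , t≤k , r) → inv↓ t≤k r) (λ { (inv↓ t≤k r) → _ , t≤k , r })
    (Fin.any? λ k → (t Fin.≤? k) ×-dec Before? w (yl k) (xl s))

  Inv-restrict-yFill : Sorted u → Inv (restrict (yFill u) v) s t ⇔ (yl t ∈ v × xl s ∈ v × Inv↓ u s t)
  Inv-restrict-yFill su with yFill-spec su
  ... | ext , filled = mk⇔
    (λ i → let (y∈ , x∈ , j) = to (Inv-restrict (sorted ext) filled) i in y∈ , x∈ , inv↓⁻ ext j)
    (λ (y∈ , x∈ , j) → from (Inv-restrict (sorted ext) filled) (y∈ , x∈ , inv↓⁺ ext j))

  xl∈wTilde⇔ : xl s ∈ wTilde u v ⇔ (xl s ∈ u × xl s ∈ v)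
  xl∈wTilde⇔ {s = s} {u = u} {v = v} = mk⇔
    (λ x∈ → proj₂ (∈-filter⁻ X? {xs = allFin m} (to xl∈xyWord⇔ x∈)))
    (λ x∈uv → from xl∈xyWord⇔ (∈-filter⁺ X? (∈-allFin s) x∈uv))
    where
    X? = λ s → (xl {m} {n} s ∈? u) ×-dec (xl s ∈? v)

  yl∈wTilde⇔ : yl t ∈ wTilde u v ⇔ (yl t ∈ u ⊎ yl t ∈ v)
  yl∈wTilde⇔ {t = t} {u = u} {v = v} = mk⇔
    (λ y∈ → proj₂ (∈-filter⁻ Y? {xs = allFin n} (to (yl∈xyWord⇔ {ss = xs}) y∈)))
    (λ y∈uv → from (yl∈xyWord⇔ {ss = xs}) (∈-filter⁺ Y? (∈-allFin t) y∈uv))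
    where
    Y? = λ t → (yl {m} {n} t ∈? u) ⊎-dec (yl t ∈? v)
    xs = filter (λ s → (xl {m} {n} s ∈? u) ×-dec (xl s ∈? v)) (allFin m)

  FilledInv : Word m n → Word m n → Fin m → Fin n → Set
  FilledInv u v s t = Inv (restrict (yFill u) (wTilde u v)) s t ⊎ Inv (restrict (yFill v) (wTilde u v)) s t

  wTilde-sorted : Sorted (wTilde u v)
  wTilde-sorted = xyWord-sorted (AllPairs.filter⁺ _ (allFin-sorted m)) (AllPairs.filter⁺ _ (allFin-sorted n))

  module Join {u v : Word m n} (su : Sorted u) (sv : Sorted v) where

    InvEither↓ : Fin m → Fin n → Set
    InvEither↓ s t = Inv↓ u s t ⊎ Inv↓ v s t

    open Merge (λ s t → Inv↓? u s t ⊎-dec Inv↓? v s t)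

    XS : List (Fin m)
    XS = filter (λ s → (xl s ∈? u) ×-dec (xl s ∈? v)) (allFin m)

    YS : List (Fin n)
    YS = filter (λ t → (yl t ∈? u) ⊎-dec (yl t ∈? v)) (allFin n)

    XS-sorted : AllPairs _<_ XS
    XS-sorted = AllPairs.filter⁺ _ (allFin-sorted m)

    YS-sorted : AllPairs _<_ YS
    YS-sorted = AllPairs.filter⁺ _ (allFin-sorted n)

    J : Word m n
    J = merge XS YS

    J-sorted : Sorted J
    J-sorted = merge-sorted XS-sorted YS-sorted

    ∈J⇔∈wTilde : c ∈ J ⇔ c ∈ wTilde u v
    ∈J⇔∈wTilde = ∈-merge⇔ {ss = XS} {YS}

    Inv↓-J⇔ : xl s ∈ J → Inv↓ J s t ⇔ InvEither↓ s t
    Inv↓-J⇔ {s = s} x∈ = mk⇔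
      (λ { (inv↓ t≤k r) → down (Before-merge⁻ XS-sorted mono s∈XS r) t≤k })
      (λ { (inj₁ (inv↓ t≤k r)) → inv↓ t≤k (before (inj₁ (Before⇒∈ˡ r)) (inj₁ (Before⇒Inv↓ r)))
         ; (inj₂ (inv↓ t≤k r)) → inv↓ t≤k (before (inj₂ (Before⇒∈ˡ r)) (inj₂ (Before⇒Inv↓ r))) })
      where
      s∈XS = xl∈merge⇒ {ts = YS} x∈
      k∈YS : ∀ {k} → yl k ∈ u ⊎ yl k ∈ v → k ∈ YS
      k∈YS {k} = ∈-filter⁺ _ (∈-allFin k)
      down : ∀ {s t k} → InvEither↓ s k → t ≤ k → InvEither↓ s t
      down (inj₁ i) t≤k = inj₁ (Inv↓-≤ t≤k i)
      down (inj₂ i) t≤k = inj₂ (Inv↓-≤ t≤k i)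
      before : ∀ {k} → yl k ∈ u ⊎ yl k ∈ v → InvEither↓ s k → Before J (yl k) (xl s)
      before k∈uv = Before-merge⁺ YS-sorted down s∈XS (k∈YS k∈uv)
      mono : ∀ {s s′ t} → s ∈ XS → s′ ∈ XS → s < s′ → InvEither↓ s t → InvEither↓ s′ t
      mono {s′ = s′} _ s′∈ s<s′ i with proj₂ (∈-filter⁻ _ {xs = allFin m} s′∈) | i
      ... | s′∈u , _ | inj₁ iu = inj₁ (Inv↓-monoˡ su s′∈u s<s′ iu)
      ... | _ , s′∈v | inj₂ iv = inj₂ (Inv↓-monoˡ sv s′∈v s<s′ iv)

    u⊑J : u ⊑ J
    u⊑J = record
      { x-⊇ = λ x∈ → proj₁ (to xl∈wTilde⇔ (to ∈J⇔∈wTilde x∈))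
      ; y-⊆ = λ y∈ → from ∈J⇔∈wTilde (from yl∈wTilde⇔ (inj₁ y∈))
      ; inv↓-⊆ = λ x∈ i → from (Inv↓-J⇔ x∈) (inj₁ i)
      }

    v⊑J : v ⊑ J
    v⊑J = record
      { x-⊇ = λ x∈ → proj₂ (to xl∈wTilde⇔ (to ∈J⇔∈wTilde x∈))
      ; y-⊆ = λ y∈ → from ∈J⇔∈wTilde (from yl∈wTilde⇔ (inj₂ y∈))
      ; inv↓-⊆ = λ x∈ i → from (Inv↓-J⇔ x∈) (inj₂ i)
      }

  module JoinOf {u v w : Word m n} (su : Shuf u) (sv : Shuf v) (join : IsJoin u v w) where

    open Join (Shuf⇒Sorted su) (Shuf⇒Sorted sv)

    sw : Sorted w
    sw = Shuf⇒Sorted (proj₁ join)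

    u⊑w : u ⊑ w
    u⊑w = ≤bub⇒⊑ (proj₁ (proj₂ join))

    v⊑w : v ⊑ w
    v⊑w = ≤bub⇒⊑ (proj₁ (proj₂ (proj₂ join)))

    w⊑J : w ⊑ J
    w⊑J = ≤bub⇒⊑ (proj₂ (proj₂ (proj₂ join)) J (Sorted⇒Shuf J-sorted)
                   (⊑⇒≤bub (Shuf⇒Sorted su) J-sorted u⊑J) (⊑⇒≤bub (Shuf⇒Sorted sv) J-sorted v⊑J))

    ∈w⇔∈wTilde : c ∈ w ⇔ c ∈ wTilde u v
    ∈w⇔∈wTilde = mk⇔ ∈w⇒ ∈wTilde⇒
      where
      ∈w⇒ : ∀ {c} → c ∈ w → c ∈ wTilde u v
      ∈w⇒ {xl _} x∈ = from xl∈wTilde⇔ (x-⊇ u⊑w x∈ , x-⊇ v⊑w x∈)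
      ∈w⇒ {yl _} y∈ = to ∈J⇔∈wTilde (y-⊆ w⊑J y∈)
      ∈wTilde⇒ : ∀ {c} → c ∈ wTilde u v → c ∈ w
      ∈wTilde⇒ {xl _} x∈ = x-⊇ w⊑J (from ∈J⇔∈wTilde x∈)
      ∈wTilde⇒ {yl _} y∈ with to yl∈wTilde⇔ y∈
      ... | inj₁ y∈u = y-⊆ u⊑w y∈u
      ... | inj₂ y∈v = y-⊆ v⊑w y∈v

    Inv↓-w⇔ : xl s ∈ w → Inv↓ w s t ⇔ InvEither↓ s t
    Inv↓-w⇔ x∈ = mk⇔
      (λ i → to (Inv↓-J⇔ x∈J) (inv↓-⊆ w⊑J x∈J i))
      (λ { (inj₁ i) → inv↓-⊆ u⊑w x∈ i ; (inj₂ i) → inv↓-⊆ v⊑w x∈ i })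
      where
      x∈J = from ∈J⇔∈wTilde (to ∈w⇔∈wTilde x∈)

    Inv-w⇔ : ∀ s t → Inv w s t ⇔ FilledInv u v s t
    Inv-w⇔ s t = mk⇔ forward backward
      where
      filled⇔ : ∀ {a} → Shuf a →
                Inv (restrict (yFill a) (wTilde u v)) s t ⇔ (yl t ∈ wTilde u v × xl s ∈ wTilde u v × Inv↓ a s t)
      filled⇔ sa = Inv-restrict-yFill (Shuf⇒Sorted sa)
      forward : Inv w s t → FilledInv u v s t
      forward i with to (Inv⇔Inv↓ sw) i
      ... | y∈ , j with to (Inv↓-w⇔ (Inv↓⇒∈ j)) j
      ...   | inj₁ ju = inj₁ (from (filled⇔ su) (to ∈w⇔∈wTilde y∈ , to ∈w⇔∈wTilde (Inv↓⇒∈ j) , ju))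
      ...   | inj₂ jv = inj₂ (from (filled⇔ sv) (to ∈w⇔∈wTilde y∈ , to ∈w⇔∈wTilde (Inv↓⇒∈ j) , jv))
      backward′ : yl t ∈ wTilde u v × xl s ∈ wTilde u v × InvEither↓ s t → Inv w s t
      backward′ (y∈ , x∈ , i) =
        from (Inv⇔Inv↓ sw) (from ∈w⇔∈wTilde y∈ , from (Inv↓-w⇔ (from ∈w⇔∈wTilde x∈)) i)
      backward : FilledInv u v s t → Inv w s t
      backward (inj₁ r) = let (y∈ , x∈ , ju) = to (filled⇔ su) r in backward′ (y∈ , x∈ , inj₁ ju)
      backward (inj₂ r) = let (y∈ , x∈ , jv) = to (filled⇔ sv) r in backward′ (y∈ , x∈ , inj₂ jv)

  -- Pairs other than (y_t , x_s) are ordered by InOrder, so only the inversions need to agree.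
  Sorted-≡ : Sorted u → Sorted z → (∀ {c} → c ∈ u → c ∈ z) → (∀ {c} → c ∈ z → c ∈ u) →
             (∀ {s t} → Inv u s t → Inv z s t) → (∀ {s t} → Inv z s t → Inv u s t) → u ≡ z
  Sorted-≡ {u = u} {z = z} su sz u⊆z z⊆u inv⁺ inv⁻ = Before-⊆⇒≡ uu uz u⊆z z⊆u before
    where
    uu = Sorted⇒Unique su
    uz = Sorted⇒Unique sz
    toZ : ∀ {s t} → Before u (yl t) (xl s) → Before z (yl t) (xl s)
    toZ r = to Inv⇔Before (inv⁺ (from Inv⇔Before r))
    toU : ∀ {s t} → Before z (yl t) (xl s) → Before u (yl t) (xl s)
    toU r = to Inv⇔Before (inv⁻ (from Inv⇔Before r))
    clash : ∀ {c d} → Before u c d → Before z d c → ⊥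
    clash {xl _} {xl _} r r′ = Fin.<-asym (AllPairs-Before su r) (AllPairs-Before sz r′)
    clash {yl _} {yl _} r r′ = Fin.<-asym (AllPairs-Before su r) (AllPairs-Before sz r′)
    clash {xl _} {yl _} r r′ = Before-asym uu r (toU r′)
    clash {yl _} {xl _} r r′ = Before-asym uz (toZ r) r′
    before : ∀ {c d} → Before u c d → Before z c d
    before r with Before-connex (u⊆z (Before⇒∈ˡ r)) (u⊆z (Before⇒∈ʳ r)) (λ { refl → Before-irrefl uu r })
    ... | inj₁ r′ = r′
    ... | inj₂ r′ = ⊥-elim (clash r r′)

  restrict-≡ : Unique w → restrict u w ⊆ w → restrict z w ⊆ w →
               (∀ {c} → c ∈ u → c ∈ z) → (∀ {c} → c ∈ z → c ∈ u) → restrict u w ≡ restrict z w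
  restrict-≡ {u = u} {z = z} uw σ τ u⊆z z⊆u = ⊆-Unique⇒≡ uw σ τ (transfer u⊆z) (transfer z⊆u)
    where
    transfer : ∀ {a b} → (∀ {c} → c ∈ a → c ∈ b) → ∀ {c} → c ∈ restrict a _ → c ∈ restrict b _
    transfer {a} a⊆b c∈ = let (c∈a , c∈w) = ∈-restrict⁻ {w = a} c∈ in ∈-restrict⁺ (a⊆b c∈a) c∈w

  restrict-≡⇒∈ : restrict u w ≡ restrict z w → c ∈ w → c ∈ u → c ∈ z
  restrict-≡⇒∈ {z = z} eq c∈w c∈u = proj₁ (∈-restrict⁻ {w = z} (subst (_ ∈_) eq (∈-restrict⁺ c∈u c∈w)))

  JoinProps-intro : Shuf z → (∀ {c} → c ∈ z ⇔ c ∈ wTilde u v) → (∀ s t → Inv z s t ⇔ FilledInv u v s t) →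
                    JoinProps u v z
  JoinProps-intro {u = u} {v = v} (_ , zx⊆ , zy⊆) ∈z⇔ inv =
      restrict-≡ (Sorted⇒Unique xword-sorted) zx⊆ wTx⊆ (to ∈z⇔) (from ∈z⇔)
    , restrict-≡ (Sorted⇒Unique yword-sorted) zy⊆ wTy⊆ (to ∈z⇔) (from ∈z⇔)
    , inv
    where
    wTx⊆ = proj₁ (proj₂ (Sorted⇒Shuf (wTilde-sorted {u = u} {v = v})))
    wTy⊆ = proj₂ (proj₂ (Sorted⇒Shuf (wTilde-sorted {u = u} {v = v})))

  JoinProps⇒∈⇔ : JoinProps u v z → c ∈ z ⇔ c ∈ wTilde u v
  JoinProps⇒∈⇔ (ex , ey , _) = mk⇔ (through ex ey) (through (sym ex) (sym ey))
    where
    through : restrict u xword ≡ restrict z xword → restrict u yword ≡ restrict z yword → c ∈ u → c ∈ z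
    through {c = xl _} ex _ = restrict-≡⇒∈ ex xl∈xword
    through {c = yl _} _ ey = restrict-≡⇒∈ ey yl∈yword

lemma4p6 : (m n : ℕ) (u v w : Word m n) → Shuf u → Shuf v →
    IsJoin u v w →
    JoinProps u v w × (∀ w' → Shuf w' → JoinProps u v w' → w' ≡ w)
lemma4p6 m n u v w su sv join = JoinProps-intro (proj₁ join) ∈w⇔∈wTilde Inv-w⇔ , unique
  where
  open JoinOf su sv join
  unique : ∀ w′ → Shuf w′ → JoinProps u v w′ → w′ ≡ w
  unique w′ sw′ props@(_ , _ , inv′) = Sorted-≡ (Shuf⇒Sorted sw′) sw
    (λ c∈ → from ∈w⇔∈wTilde (to (JoinProps⇒∈⇔ props) c∈))
    (λ c∈ → from (JoinProps⇒∈⇔ props) (to ∈w⇔∈wTilde c∈))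
    (λ i → from (Inv-w⇔ _ _) (to (inv′ _ _) i))
    (λ i → from (inv′ _ _) (to (Inv-w⇔ _ _) i))
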